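{- Let $\mathbf{A}$ be a composition of operators from $\{\mathbf{S},\mathbf{R}\}$. If $\mathbf{A}$ respects $P$, then $\mathbf{A}\circ\mathbf{R}$ respects $P$.
   Context: Notation and conventions. - Permutations of $[n]$ are in one-line notation, with composition $(\lambda\circ\sigma)(i)=\lambda(\sigma(i))$. - A sequence of distinct integers is identified with the permutation order-isomorphic to it. - $\mathrm{Av}(231)$ (resp. $\mathrm{Av}(132)$) is the set of permutations avoiding $231$ (resp. $132$). Operators. - $\mathbf{S}(\varepsilon)=\varepsilon$ and $\mathbf{S}(\alpha n\beta)=\mathbf{S}(\alpha)\mathbf{S}(\beta)n$, where $n$ is the maximum entry. - $\mathbf{R}$ is reversal. The bijection $P$. - $\alpha\oplus\beta=\alpha(\beta+|\alpha|)$ and $\alpha\ominus\beta=(\alpha+|\beta|)\beta$. - $P:\mathrm{Av}(231)\to\mathrm{Av}(132)$ is defined by $P(\varepsilon)=\varepsilon$ and $P(\alpha\oplus(1\ominus\beta))=(P(\alpha)\oplus1)\ominus P(\beta)$, using the unique decomposition of nonempty $231$-avoiders. - For $\pi\in\mathrm{Av}(231)$ of size $n$, $\lambda_\pi$ is the permutation of $[n]$ with $P(\pi)=\lambda_\pi\circ\pi$. Trees. - A binary tree is decreasing if every child's label is smaller than its parent's. - The in-order reading is (left subtree reading)(root)(right subtree reading). - $\mathrm{T}_{\mathrm{in}}(\pi)$ is the unique decreasing binary tree with in-order reading $\pi$. - $\lambda(T)$ denotes $T$ with every label $\ell$ replaced by $\lambda(\ell)$. Respecting $P$. An operator $\mathbf{A}$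 respects $P$ if, for every $n$ and every $\pi\in\mathrm{Av}(231)$ of size $n$ lying in the image of $\mathbf{A}$: - (i) every $\theta$ with $\mathbf{A}(\theta)=\pi$ satisfies $\mathbf{A}(\lambda_\pi\circ\theta)=P(\pi)$ and $\mathrm{T}_{\mathrm{in}}(\lambda_\pi\circ\theta)=\lambda_\pi(\mathrm{T}_{\mathrm{in}}(\theta))$; - (ii) $\theta\mapsto\lambda_\pi\circ\theta$ is a bijection from $\mathbf{A}^{ -1}(\pi)$ onto $\mathbf{A}^{ -1}(P(\pi))$. -}

module Defs where

open import Data.Nat using (ℕ; zero; suc; _+_; _∸_; _<_; _⊔_; _≡ᵇ_)
open import Data.Bool using (if_then_else_)
open import Data.List using (List; []; _∷_; _++_; [_]; map; foldr; length; reverse; upTo)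
open import Data.List.NonEmpty using (List⁺; _∷_)
open import Data.List.Relation.Binary.Permutation.Propositional using (_↭_)
open import Data.List.Relation.Binary.Sublist.Propositional using (_⊆_)
open import Data.Product using (_×_; _,_; proj₁; proj₂; Σ; ∃)
open import Relation.Binary.PropositionalEquality using (_≡_)
open import Relation.Nullary using (¬_)
open import Function using (_∘_; id)

-- Permutations / sequences in one-line notation as lists of naturals.
-- A permutation of [n] is a list that is a rearrangement of 1,2,…,n.
oneTo : ℕ → List ℕ
oneTo n = map suc (upTo n)

IsPerm : ℕ → List ℕ → Set
IsPerm n xs = xs ↭ oneTo n

Contains231 : List ℕ → Set
Contains231 xs = ∃ λ a → ∃ λ b → ∃ λ c → ((a ∷ b ∷ c ∷ []) ⊆ xs) × (c < a × a < b)

Av231 : List ℕ → Set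
Av231 xs = ¬ Contains231 xs

-- 1-indexed entry: at xs i = xs(i)  (0 if out of range, never used on permutations)
at : List ℕ → ℕ → ℕ
at [] _ = 0
at (x ∷ xs) zero = 0
at (x ∷ xs) (suc zero) = x
at (x ∷ xs) (suc (suc i)) = at xs (suc i)

pos : ℕ → List ℕ → ℕ
pos v [] = 0
pos v (x ∷ xs) = if x ≡ᵇ v then 1 else suc (pos v xs)

_∘ₚ_ : List ℕ → List ℕ → List ℕ
l ∘ₚ σ = map (at l) σ

inverse : List ℕ → List ℕ
inverse σ = map (λ v → pos v σ) (oneTo (length σ))

maxL : List ℕ → ℕ
maxL = foldr _⊔_ 0

splitOn : ℕ → List ℕ → List ℕ × List ℕ
splitOn m [] = [] , []
splitOn m (x ∷ xs) = if x ≡ᵇ m then ([] , xs)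
                     else (x ∷ proj₁ (splitOn m xs) , proj₂ (splitOn m xs))

Sf : ℕ → List ℕ → List ℕ
Sf zero _ = []
Sf (suc f) [] = []
Sf (suc f) xs@(_ ∷ _) =
  let m = maxL xs ; ab = splitOn m xs
  in Sf f (proj₁ ab) ++ Sf f (proj₂ ab) ++ [ m ]

S : List ℕ → List ℕ
S xs = Sf (length xs) xs

R : List ℕ → List ℕ
R = reverse

data Op : Set where
  opS opR : Op

⟦_⟧op : Op → List ℕ → List ℕ
⟦ opS ⟧op = S
⟦ opR ⟧op = R

⟦_⟧ : List⁺ Op → List ℕ → List ℕ
⟦ o ∷ os ⟧ = ⟦ o ⟧op ∘ foldr (λ o' f → ⟦ o' ⟧op ∘ f) id os

-- The bijection P, on a 231-avoiding permutation π = α ⊕ (1 ⊖ β) = α' n β'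
-- (α = α', β = β' - |α|):  P(π) = (P(α) + |β|) n P(β) = (P(α) ⊕ 1) ⊖ P(β).
Pf : ℕ → List ℕ → List ℕ
Pf zero _ = []
Pf (suc f) [] = []
Pf (suc f) xs@(_ ∷ _) =
  let m = maxL xs ; ab = splitOn m xs
      α = proj₁ ab ; β = map (λ x → x ∸ length α) (proj₂ ab)
  in map (λ x → x + length β) (Pf f α) ++ [ m ] ++ Pf f β

P : List ℕ → List ℕ
P xs = Pf (length xs) xs

-- λ_π : the permutation with P(π) = λ_π ∘ π, i.e. λ_π = P(π) ∘ π⁻¹
lam : List ℕ → List ℕ
lam π = P π ∘ₚ inverse π

data Tree : Set where
  leaf : Tree
  node : Tree → ℕ → Tree → Tree

mapT : (ℕ → ℕ) → Tree → Tree
mapT g leaf = leaf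
mapT g (node l x r) = node (mapT g l) (g x) (mapT g r)

-- T_in(π): decreasing binary tree with in-order reading π
-- (root = maximum, left/right subtrees built from the parts before/after it)
Tf : ℕ → List ℕ → Tree
Tf zero _ = leaf
Tf (suc f) [] = leaf
Tf (suc f) xs@(_ ∷ _) =
  let m = maxL xs ; ab = splitOn m xs
  in node (Tf f (proj₁ ab)) m (Tf f (proj₂ ab))

Tin : List ℕ → Tree
Tin xs = Tf (length xs) xs

Respects : (List ℕ → List ℕ) → Set
Respects A =
  ∀ (n : ℕ) (π : List ℕ) → IsPerm n π → Av231 π →
  (∃ λ θ → IsPerm n θ × A θ ≡ π) →
  (∀ θ → IsPerm n θ → A θ ≡ π →
     A (lam π ∘ₚ θ) ≡ P π × Tin (lam π ∘ₚ θ) ≡ mapT (at (lam π)) (Tin θ))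
  ×
  -- (ii) θ ↦ λ_π ∘ θ is a bijection A⁻¹(π) → A⁻¹(P π)  (preimages inside S_n)
  ( (∀ θ → IsPerm n θ → A θ ≡ π →
       IsPerm n (lam π ∘ₚ θ) × A (lam π ∘ₚ θ) ≡ P π)
  × (∀ θ₁ θ₂ → IsPerm n θ₁ → A θ₁ ≡ π → IsPerm n θ₂ → A θ₂ ≡ π →
       lam π ∘ₚ θ₁ ≡ lam π ∘ₚ θ₂ → θ₁ ≡ θ₂)
  × (∀ θ' → IsPerm n θ' → A θ' ≡ P π →
       ∃ λ θ → IsPerm n θ × A θ ≡ π × lam π ∘ₚ θ ≡ θ'))

module Submission where

-- Reversal acts on positions while λ_π ∘ − acts on values, so the two commute;
-- reversal also preserves being a permutation of [n], and it mirrors T_in, which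
-- commutes with relabelling. Hence each condition for A ∘ R at θ is the matching
-- condition for A at reverse θ. Nothing about A beyond "respects P" is used.

open import Defs
open import Data.List.NonEmpty using (List⁺)
open import Function using (_∘_)

open import Data.Nat using (ℕ; zero; suc; _⊔_; _≡ᵇ_)
open import Data.Nat.Properties using (≡ᵇ⇒≡; ≡⇒≡ᵇ; ⊔-sel; ⊔-comm; ⊔-assoc; ⊔-identityʳ; suc-injective)
open import Data.Bool using (true; false)
open import Data.List using (List; []; _∷_; _++_; [_]; reverse; length)
open import Data.List.Properties
  using (reverse-++; unfold-reverse; length-reverse; reverse-map; reverse-involutive; reverse-injective; ++-assoc)
open import Data.List.Membership.Propositional using (_∈_; _∉_)
open import Data.List.Membership.Propositional.Properties using (∈-∃++)
open import Data.List.Relation.Unary.Any using (here; there)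
open import Data.List.Relation.Unary.All using (head)
open import Data.List.Relation.Unary.AllPairs using ([]; _∷_)
import Data.List.Relation.Unary.All.Properties as All
open import Data.List.Relation.Unary.Unique.Propositional using (Unique)
import Data.List.Relation.Unary.Unique.Propositional.Properties as Unique
open import Data.List.Relation.Binary.Permutation.Propositional using (↭-sym; ↭-trans; ↭⇒↭ₛ)
open import Data.List.Relation.Binary.Permutation.Propositional.Properties using (↭-reverse; ∈-resp-↭)
import Data.List.Relation.Binary.Permutation.Setoid.Properties as Permutationₛ
open import Data.Product using (_×_; _,_; proj₁; proj₂; ∃)
open import Data.Empty using (⊥-elim)
open import Data.Sum using (inj₁; inj₂)
open import Relation.Binary.PropositionalEquality
  using (_≡_; refl; sym; trans; cong; cong₂; subst; setoid; module ≡-Reasoning)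

mirror : Tree → Tree
mirror leaf = leaf
mirror (node l x r) = node (mirror r) x (mirror l)

mirror-involutive : ∀ t → mirror (mirror t) ≡ t
mirror-involutive leaf = refl
mirror-involutive (node l x r) = cong₂ (λ l′ r′ → node l′ x r′) (mirror-involutive l) (mirror-involutive r)

mirror-injective : ∀ {s t} → mirror s ≡ mirror t → s ≡ t
mirror-injective {s} {t} eq =
  trans (sym (mirror-involutive s)) (trans (cong mirror eq) (mirror-involutive t))

mapT-mirror : ∀ g t → mapT g (mirror t) ≡ mirror (mapT g t)
mapT-mirror g leaf = refl
mapT-mirror g (node l x r) = cong₂ (λ l′ r′ → node l′ (g x) r′) (mapT-mirror g r) (mapT-mirror g l)

maxL-++ : ∀ xs ys → maxL (xs ++ ys) ≡ maxL xs ⊔ maxL ys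
maxL-++ [] ys = refl
maxL-++ (x ∷ xs) ys = trans (cong (x ⊔_) (maxL-++ xs ys)) (sym (⊔-assoc x (maxL xs) (maxL ys)))

maxL-reverse : ∀ xs → maxL (reverse xs) ≡ maxL xs
maxL-reverse [] = refl
maxL-reverse (x ∷ xs) = begin
  maxL (reverse (x ∷ xs))       ≡⟨ cong maxL (unfold-reverse x xs) ⟩
  maxL (reverse xs ++ [ x ])    ≡⟨ maxL-++ (reverse xs) [ x ] ⟩
  maxL (reverse xs) ⊔ (x ⊔ 0)   ≡⟨ cong₂ _⊔_ (maxL-reverse xs) (⊔-identityʳ x) ⟩
  maxL xs ⊔ x                   ≡⟨ ⊔-comm (maxL xs) x ⟩
  x ⊔ maxL xs                   ∎
  where open ≡-Reasoning

maxL∈ : ∀ x xs → maxL (x ∷ xs) ∈ x ∷ xs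
maxL∈ x [] = here (⊔-identityʳ x)
maxL∈ x (y ∷ ys) with ⊔-sel x (maxL (y ∷ ys))
... | inj₁ x⊔m≡x = here x⊔m≡x
... | inj₂ x⊔m≡m = there (subst (_∈ y ∷ ys) (sym x⊔m≡m) (maxL∈ y ys))

Unique-++-∷⁻ : ∀ (α : List ℕ) {m β} → Unique (α ++ m ∷ β) → m ∉ α × m ∉ β × Unique α × Unique β
Unique-++-∷⁻ [] u@(_ ∷ uβ) = (λ ()) , Unique.Unique[x∷xs]⇒x∉xs u , [] , uβ
Unique-++-∷⁻ (a ∷ α) {m} (a≢ ∷ u) with Unique-++-∷⁻ α u
... | m∉α , m∉β , uα , uβ = m∉a∷α , m∉β , All.++⁻ˡ α a≢ ∷ uα , uβ
  where
  m∉a∷α : m ∉ a ∷ α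
  m∉a∷α (here m≡a) = head (All.++⁻ʳ α a≢) (sym m≡a)
  m∉a∷α (there m∈α) = m∉α m∈α

splitOn-++ : ∀ {m} (α β : List ℕ) → m ∉ α → splitOn m (α ++ m ∷ β) ≡ (α , β)
splitOn-++ {m} [] β _ with m ≡ᵇ m | ≡⇒≡ᵇ m m refl
... | true | _ = refl
... | false | ()
splitOn-++ {m} (a ∷ α) β m∉a∷α with a ≡ᵇ m | ≡ᵇ⇒≡ a m
... | true | a≡m = ⊥-elim (m∉a∷α (here (sym (a≡m _))))
... | false | _ = cong (λ (α′ , β′) → (a ∷ α′ , β′)) (splitOn-++ α β (m∉a∷α ∘ there))

Tf-split : ∀ f (α : List ℕ) {m} β → maxL (α ++ m ∷ β) ≡ m → m ∉ α →
           Tf (suc f) (α ++ m ∷ β) ≡ node (Tf f α) m (Tf f β)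
Tf-split f []      β max≡m m∉α rewrite max≡m | splitOn-++ [] β m∉α = refl
Tf-split f (a ∷ α) β max≡m m∉α rewrite max≡m | splitOn-++ (a ∷ α) β m∉α = refl

reverse-++-∷ : ∀ (α : List ℕ) m β → reverse (α ++ m ∷ β) ≡ reverse β ++ m ∷ reverse α
reverse-++-∷ α m β = begin
  reverse (α ++ m ∷ β)                ≡⟨ reverse-++ α (m ∷ β) ⟩
  reverse (m ∷ β) ++ reverse α        ≡⟨ cong (_++ reverse α) (unfold-reverse m β) ⟩
  (reverse β ++ [ m ]) ++ reverse α   ≡⟨ ++-assoc (reverse β) [ m ] (reverse α) ⟩
  reverse β ++ m ∷ reverse α          ∎
  where open ≡-Reasoning

Tf-reverse-step : ∀ f (α : List ℕ) {m} β → maxL (α ++ m ∷ β) ≡ m → Unique (α ++ m ∷ β) →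
                  (∀ xs → Unique xs → Tf f (reverse xs) ≡ mirror (Tf f xs)) →
                  Tf (suc f) (reverse (α ++ m ∷ β)) ≡ mirror (Tf (suc f) (α ++ m ∷ β))
Tf-reverse-step f α {m} β max≡m u ih with Unique-++-∷⁻ α u
... | m∉α , m∉β , uα , uβ = begin
  Tf (suc f) (reverse (α ++ m ∷ β))               ≡⟨ cong (Tf (suc f)) (reverse-++-∷ α m β) ⟩
  Tf (suc f) (reverse β ++ m ∷ reverse α)         ≡⟨ Tf-split f (reverse β) (reverse α) max′≡m m∉β′ ⟩
  node (Tf f (reverse β)) m (Tf f (reverse α))    ≡⟨ cong₂ (λ l r → node l m r) (ih β uβ) (ih α uα) ⟩
  mirror (node (Tf f α) m (Tf f β))               ≡⟨ cong mirror (Tf-split f α β max≡m m∉α) ⟨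
  mirror (Tf (suc f) (α ++ m ∷ β))                ∎
  where
  open ≡-Reasoning
  max′≡m : maxL (reverse β ++ m ∷ reverse α) ≡ m
  max′≡m = trans (cong maxL (sym (reverse-++-∷ α m β))) (trans (maxL-reverse (α ++ m ∷ β)) max≡m)
  m∉β′ : m ∉ reverse β
  m∉β′ = m∉β ∘ ∈-resp-↭ (↭-reverse β)

-- Both sides spend the same fuel, so no bound length xs ≤ f is needed; distinctness
-- is, since splitOn cuts at the first occurrence of the maximum.
Tf-reverse : ∀ f xs → Unique xs → Tf f (reverse xs) ≡ mirror (Tf f xs)
Tf-reverse zero    xs       _ = refl
Tf-reverse (suc f) []       _ = refl
Tf-reverse (suc f) (x ∷ xs) u with ∈-∃++ (maxL∈ x xs)
... | α , β , eq =
  subst (λ ys → Tf (suc f) (reverse ys) ≡ mirror (Tf (suc f) ys)) (sym eq)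
        (Tf-reverse-step f α β (cong maxL (sym eq)) (subst Unique eq u) (Tf-reverse f))

Tin-reverse : ∀ xs → Unique xs → Tin (reverse xs) ≡ mirror (Tin xs)
Tin-reverse xs u = trans (cong (λ f → Tf f (reverse xs)) (length-reverse xs)) (Tf-reverse (length xs) xs u)

IsPerm-reverse : ∀ {n xs} → IsPerm n xs → IsPerm n (reverse xs)
IsPerm-reverse {xs = xs} p = ↭-trans (↭-reverse xs) p

IsPerm-reverse⁻ : ∀ {n xs} → IsPerm n (reverse xs) → IsPerm n xs
IsPerm-reverse⁻ {xs = xs} p = ↭-trans (↭-sym (↭-reverse xs)) p

IsPerm⇒Unique : ∀ {n xs} → IsPerm n xs → Unique xs
IsPerm⇒Unique {n} p =
  Permutationₛ.Unique-resp-↭ (setoid ℕ) (↭⇒↭ₛ (↭-sym p)) (Unique.map⁺ suc-injective (Unique.upTo⁺ n))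

∘ₚ-reverse : ∀ l θ → l ∘ₚ reverse θ ≡ reverse (l ∘ₚ θ)
∘ₚ-reverse l = reverse-map (at l)

Tin-∘ₚ-reverse⁻ : ∀ l θ → Unique θ → Unique (l ∘ₚ θ) →
                  Tin (l ∘ₚ reverse θ) ≡ mapT (at l) (Tin (reverse θ)) →
                  Tin (l ∘ₚ θ) ≡ mapT (at l) (Tin θ)
Tin-∘ₚ-reverse⁻ l θ uθ ulθ hyp = mirror-injective (begin
  mirror (Tin (l ∘ₚ θ))             ≡⟨ Tin-reverse (l ∘ₚ θ) ulθ ⟨
  Tin (reverse (l ∘ₚ θ))            ≡⟨ cong Tin (∘ₚ-reverse l θ) ⟨
  Tin (l ∘ₚ reverse θ)              ≡⟨ hyp ⟩
  mapT (at l) (Tin (reverse θ))     ≡⟨ cong (mapT (at l)) (Tin-reverse θ uθ) ⟩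
  mapT (at l) (mirror (Tin θ))      ≡⟨ mapT-mirror (at l) (Tin θ) ⟩
  mirror (mapT (at l) (Tin θ))      ∎)
  where open ≡-Reasoning

Respects-∘-reverse : (B : List ℕ → List ℕ) → Respects B → Respects (B ∘ reverse)
Respects-∘-reverse B respects n π π-perm π-avoids (θ₀ , θ₀-perm , Bθ₀≡π)
  with respects n π π-perm π-avoids (reverse θ₀ , IsPerm-reverse θ₀-perm , Bθ₀≡π)
... | relabels , maps-to , injective , surjective =
  (λ θ p e → image θ p e , tree θ p e) , (λ θ p e → image-perm θ p e , image θ p e) , injective′ , preimage
  where
  L = lam π
  image : ∀ θ → IsPerm n θ → B (reverse θ) ≡ π → B (reverse (L ∘ₚ θ)) ≡ P π
  image θ p e = subst (λ θ′ → B θ′ ≡ P π) (∘ₚ-reverse L θ) (proj₁ (relabels (reverse θ) (IsPerm-reverse p) e))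
  image-perm : ∀ θ → IsPerm n θ → B (reverse θ) ≡ π → IsPerm n (L ∘ₚ θ)
  image-perm θ p e =
    IsPerm-reverse⁻ (subst (IsPerm n) (∘ₚ-reverse L θ) (proj₁ (maps-to (reverse θ) (IsPerm-reverse p) e)))
  tree : ∀ θ → IsPerm n θ → B (reverse θ) ≡ π → Tin (L ∘ₚ θ) ≡ mapT (at L) (Tin θ)
  tree θ p e = Tin-∘ₚ-reverse⁻ L θ (IsPerm⇒Unique p) (IsPerm⇒Unique (image-perm θ p e))
                               (proj₂ (relabels (reverse θ) (IsPerm-reverse p) e))
  injective′ : ∀ θ₁ θ₂ → IsPerm n θ₁ → B (reverse θ₁) ≡ π → IsPerm n θ₂ → B (reverse θ₂) ≡ π →
               L ∘ₚ θ₁ ≡ L ∘ₚ θ₂ → θ₁ ≡ θ₂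
  injective′ θ₁ θ₂ p₁ e₁ p₂ e₂ Lθ₁≡Lθ₂ = reverse-injective
    (injective (reverse θ₁) (reverse θ₂) (IsPerm-reverse p₁) e₁ (IsPerm-reverse p₂) e₂
      (trans (∘ₚ-reverse L θ₁) (trans (cong reverse Lθ₁≡Lθ₂) (sym (∘ₚ-reverse L θ₂)))))
  preimage : ∀ θ′ → IsPerm n θ′ → B (reverse θ′) ≡ P π →
             ∃ λ θ → IsPerm n θ × B (reverse θ) ≡ π × L ∘ₚ θ ≡ θ′
  preimage θ′ p′ e′ with surjective (reverse θ′) (IsPerm-reverse p′) e′
  ... | θ , p , e , Lθ≡θ′ =
    reverse θ , IsPerm-reverse p , subst (λ θ″ → B θ″ ≡ π) (sym (reverse-involutive θ)) e ,
    trans (∘ₚ-reverse L θ) (trans (cong reverse Lθ≡θ′) (reverse-involutive θ′))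

proposition4p5 : (A : List⁺ Op) → Respects ⟦ A ⟧ → Respects (⟦ A ⟧ ∘ R)
proposition4p5 A = Respects-∘-reverse ⟦ A ⟧
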